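{- Let $t\ge1$, $n=2t^2+2t+1$, let $\mathcal{C}_0\subseteq\mathbb{Z}_n^2$ be a linear $t$-error-correcting perfect code with generator matrix $[a~~b]$, and let $\mathcal{C}=\mathbf{x}+\mathcal{C}_0$ for some $\mathbf{x}=(x_1,x_2)\in\mathbb{Z}_n^2$. Let $\mathcal{S}$ be the set of all perfect Sudoku grids with respect to $\mathcal{C}$, and define \[ \mathcal{G}_\mathcal{S}=\langle \tau_2^{x_1+x_2+1}\tau_1^{x_1-x_2}r,\ \tau_1^a\tau_2^b\rangle. \] Then for every $S\in\mathcal{S}$ and every $g\in\mathcal{G}_\mathcal{S}$, we have $g(S)\in\mathcal{S}$.
   Context: $\mathbb{Z}_n$ is the ring of integers modulo $n$; the Lee weight of $\mathbf{u}=(u_1,u_2)\in\mathbb{Z}_n^2$ (entries in $\{0,\dots,n-1\}$) is $\sum_i\min\{u_i,n-u_i\}$ and the Lee distance is $d_L(\mathbf{u},\mathbf{v})=\mathrm{wt}_L(\mathbf{u}-\mathbf{v})$. A code is a subset of $\mathbb{Z}_n^2$, linear if a submodule; the code with generator matrix $[a~~b]$ is $\{k(a,b):k\in\mathbb{Z}_n\}$. $\mathcal{B}_t(\mathbf{c})$ is the set of points at Lee distance $\le t$ from $\mathbf{c}$ (it has $n$ elements). A $t$-error-correcting perfect code $\mathcal{C}\subseteq\mathbb{Z}_n^2$ is a code of minimum Lee distance $2t+1$ such that the balls $\mathcal{B}_t(\mathbf{c})$, $\mathbf{c}\in\mathcal{C}$, cover (hence partition) $\mathbb{Z}_n^2$;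 then $|\mathcal{C}|=n$. For such $\mathcal{C}=\{\mathbf{c}_1,\dots,\mathbf{c}_n\}$, the palette grid $\mathcal{I}_\mathcal{C}$ is the $n\times n$ array with rows and columns indexed by $0,1,\dots,n-1$ whose entry at $(x,y)$ is $i$ whenever $(x,y)\in\mathcal{B}_t(\mathbf{c}_i)$. Two $n\times n$ arrays $A,B$ with entries in $[n]=\{1,\dots,n\}$ are orthogonal if the $n^2$ ordered pairs $(A_{ij},B_{ij})$ are pairwise distinct. A perfect Sudoku grid with respect to $\mathcal{C}$ is an $n\times n$ array over $[n]$ that is a Latin square and is orthogonal to $\mathcal{I}_\mathcal{C}$. On $n\times n$ arrays $A$ (indices in $\{0,\dots,n-1\}$, taken mod $n$) define $(r(A))_{i,j}=A_{n-1-j,i}$ (rotation), $(\tau_1(A))_{i,j}=A_{i-1,j}$ and $(\tau_2(A))_{i,j}=A_{i,j-1}$ (translations); products mean composition, $\varphi_1\varphi_2(A)=\varphi_1(\varphi_2(A))$, and $\mathcal{G}_\mathcal{S}$ is the group they generate under composition. -}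

module Defs where

open import Data.Nat using (ℕ; zero; suc; _+_; _*_; _∸_; _≤_; _⊓_; NonZero)
open import Data.Nat.DivMod using (_mod_)
open import Data.Fin using (Fin; toℕ; opposite)
open import Data.Product using (Σ; ∃; ∃-syntax; _×_; _,_)
open import Relation.Binary.PropositionalEquality using (_≡_; _≢_)
open import Function.Definitions using (Injective)

-- n = 2t^2 + 2t + 1 (written as a successor, so NonZero is automatic)
N : ℕ → ℕ
N t = suc (2 * t * t + 2 * t)

module _ {n : ℕ} {{_ : NonZero n}} where

  _+ₙ_ : Fin n → Fin n → Fin n
  u +ₙ v = (toℕ u + toℕ v) mod n

  -ₙ_ : Fin n → Fin n
  -ₙ u = (n ∸ toℕ u) mod n

  _-ₙ_ : Fin n → Fin n → Fin n
  u -ₙ v = u +ₙ (-ₙ v)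

  _*ₙ_ : Fin n → Fin n → Fin n
  u *ₙ v = (toℕ u * toℕ v) mod n

  oneₙ : Fin n
  oneₙ = 1 mod n

  Pt : Set
  Pt = Fin n × Fin n

  _+ᵖ_ : Pt → Pt → Pt
  (u₁ , u₂) +ᵖ (v₁ , v₂) = (u₁ +ₙ v₁) , (u₂ +ₙ v₂)

  _-ᵖ_ : Pt → Pt → Pt
  (u₁ , u₂) -ᵖ (v₁ , v₂) = (u₁ -ₙ v₁) , (u₂ -ₙ v₂)

  _·ᵖ_ : Fin n → Pt → Pt
  k ·ᵖ (u₁ , u₂) = (k *ₙ u₁) , (k *ₙ u₂)

  leeEntry : Fin n → ℕ
  leeEntry u = toℕ u ⊓ (n ∸ toℕ u)

  wtL : Pt → ℕ
  wtL (u₁ , u₂) = leeEntry u₁ + leeEntry u₂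

  dL : Pt → Pt → ℕ
  dL u v = wtL (u -ᵖ v)

  Code : Set₁
  Code = Pt → Set

  Ball : ℕ → Pt → Pt → Set
  Ball t c p = dL p c ≤ t

  genCode : Fin n → Fin n → Code
  genCode a b p = ∃[ k ] p ≡ k ·ᵖ (a , b)

  translate : Pt → Code → Code
  translate x C p = ∃[ c ] (C c × p ≡ x +ᵖ c)

  MinDist : Code → ℕ → Set
  MinDist C d =
    (∀ c c′ → C c → C c′ → c ≢ c′ → d ≤ dL c c′) ×
    (∃[ c ] ∃[ c′ ] (C c × C c′ × c ≢ c′ × dL c c′ ≡ d))

  IsPerfectCode : ℕ → Code → Set
  IsPerfectCode t C =
    MinDist C (2 * t + 1) × (∀ p → ∃[ c ] (C c × Ball t c p))

  Array : Set
  Array = Fin n → Fin n → Fin n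

  Latin : Array → Set
  Latin A = (∀ i → Injective _≡_ _≡_ (λ j → A i j)) ×
            (∀ j → Injective _≡_ _≡_ (λ i → A i j))

  Orthogonal : Array → Array → Set
  Orthogonal A B = ∀ i j i′ j′ → A i j ≡ A i′ j′ → B i j ≡ B i′ j′ →
                   (i ≡ i′ × j ≡ j′)

  IsPaletteGrid : ℕ → Code → Array → Set
  IsPaletteGrid t C I = Σ (Fin n → Pt) λ c →
    Injective _≡_ _≡_ c ×
    (∀ i → C (c i)) ×
    (∀ p → C p → ∃[ i ] c i ≡ p) ×
    (∀ x y i → Ball t (c i) (x , y) → I x y ≡ i)

  PerfectSudoku : ℕ → Code → Array → Set
  PerfectSudoku t C S = Latin S × ∃[ I ] (IsPaletteGrid t C I × Orthogonal S I)

  rot : Array → Array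
  rot A i j = A (opposite j) i

  rotInv : Array → Array
  rotInv B i j = B j (opposite i)

  τ₁^ : Fin n → Array → Array
  τ₁^ k A i j = A (i -ₙ k) j

  τ₂^ : Fin n → Array → Array
  τ₂^ k A i j = A i (j -ₙ k)

  data GWord : Set where
    ε    : GWord
    g₁   : GWord
    g₂   : GWord
    g₁⁻¹ : GWord
    g₂⁻¹ : GWord
    _∙_  : GWord → GWord → GWord

  ⟦_⟧ : GWord → (a b x₁ x₂ : Fin n) → Array → Array
  ⟦ ε ⟧    a b x₁ x₂ A = A
  ⟦ g₁ ⟧   a b x₁ x₂ A = τ₂^ ((x₁ +ₙ x₂) +ₙ oneₙ) (τ₁^ (x₁ -ₙ x₂) (rot A))
  ⟦ g₂ ⟧   a b x₁ x₂ A = τ₁^ a (τ₂^ b A)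
  ⟦ g₁⁻¹ ⟧ a b x₁ x₂ A = rotInv (τ₁^ (-ₙ (x₁ -ₙ x₂)) (τ₂^ (-ₙ ((x₁ +ₙ x₂) +ₙ oneₙ)) A))
  ⟦ g₂⁻¹ ⟧ a b x₁ x₂ A = τ₂^ (-ₙ b) (τ₁^ (-ₙ a) A)
  ⟦ w ∙ v ⟧ a b x₁ x₂ A = ⟦ w ⟧ a b x₁ x₂ (⟦ v ⟧ a b x₁ x₂ A)

-- Each generator of G_S acts by precomposing an array with a bijection of the
-- cells Z_n^2 that is a Lee isometry, maps C = x + C₀ onto itself and sends rows
-- and columns to rows or columns. Such a map preserves the Latin property and
-- orthogonality, and it carries the palette grid of C to a palette grid of C
-- (with the codewords re-enumerated). τ₁^a τ₂^b is the translation by the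
-- codeword (a,b) and g₁ is the quarter turn about x, so everything reduces to
-- the invariance of C₀ under (u,v) ↦ (-v,u). Minimum distance 2t+1 forces the
-- codewords covering (t+1,0) and (0,t+1) to be (t+1+d, ±(t-d)) and
-- (±(t-e), t+1+e); both are multiples of (a,b), so their determinant vanishes
-- mod n. With equal signs it is (2t+1)(1+d+e), a number in (0,2n) other than n
-- because n = 2t²+2t+1 lies strictly between two consecutive multiples of 2t+1;
-- with opposite signs it is n + (d+e+2de) with d+e+2de < n, so d = e = 0. Hence
-- the codewords are k₁(a,b) = (t+1, σt) and its quarter turn k₂(a,b), and as
-- a - σb inverts k₁, the quarter turn of (a,b) is (a - σb)k₂ (a,b).

module Submission where

open import Defs
open import Algebra.Bundles using (CommutativeRing)
open import Algebra.Structures using (IsCommutativeRing)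
open import Algebra.Consequences.Propositional
  using (comm∧idˡ⇒id; comm∧invˡ⇒inv; comm∧distrʳ⇒distrˡ)
import Algebra.Properties.Ring as RingProperties
import Algebra.Solver.Ring as RingSolver
open import Algebra.Solver.Ring.AlmostCommutativeRing
  using (_-Raw-AlmostCommutative⟶_; fromCommutativeRing)
open import Data.Empty using (⊥-elim)
open import Data.Fin using (Fin; toℕ; opposite)
import Data.Fin.Properties as Finₚ
open import Data.Integer as ℤ using (ℤ; -[1+_]; _⊖_)
import Data.Integer.Properties as ℤₚ
import Data.Maybe as Maybe
open import Data.Nat as ℕ using (ℕ; zero; suc; NonZero; _≤_; _<_; z≤n; s≤s)
open import Data.Nat.DivMod
  using (_mod_; _%_; m%n<n; m%n≤m; m<n⇒m%n≡m; n%n≡0; %-distribˡ-+; %-distribˡ-*)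
open import Data.Nat.Divisibility using (_∣_; divides; m%n≡0⇒n∣m)
import Data.Nat.Properties as ℕₚ
open import Data.Nat.Tactic.RingSolver using (solve-∀)
open import Data.Product using (∃; _×_; _,_; proj₁; proj₂; uncurry)
open import Data.Sign as Sign using (Sign)
import Data.Sign.Properties as Signₚ
open import Data.Sum using (inj₁; inj₂)
open import Function using (_∘_)
open import Function.Definitions using (Injective)
open import Relation.Binary.PropositionalEquality hiding ([_])
open import Relation.Binary.PropositionalEquality.Algebra using (isMagma)
open import Relation.Nullary.Decidable using (dec⇒maybe)

module Modular (n : ℕ) {{_ : NonZero n}} where

  open ≡-Reasoning

  [_] : ℕ → Fin n
  [ m ] = m mod n

  toℕ-[] : ∀ m → toℕ [ m ] ≡ m % n
  toℕ-[] m = Finₚ.toℕ-fromℕ< (m%n<n m n)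

  [toℕ] : ∀ u → [ toℕ u ] ≡ u
  [toℕ] u = Finₚ.toℕ-injective (trans (toℕ-[] (toℕ u)) (m<n⇒m%n≡m (Finₚ.toℕ<n u)))

  []-cong-% : ∀ {m k} → m % n ≡ k % n → [ m ] ≡ [ k ]
  []-cong-% {m} {k} e = Finₚ.toℕ-injective (trans (toℕ-[] m) (trans e (sym (toℕ-[] k))))

  []-+ : ∀ m k → [ m ℕ.+ k ] ≡ [ m ] +ₙ [ k ]
  []-+ m k = []-cong-% (trans (%-distribˡ-+ m k n)
    (sym (cong₂ (λ x y → (x ℕ.+ y) % n) (toℕ-[] m) (toℕ-[] k))))

  []-* : ∀ m k → [ m ℕ.* k ] ≡ [ m ] *ₙ [ k ]
  []-* m k = []-cong-% (trans (%-distribˡ-* m k n)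
    (sym (cong₂ (λ x y → (x ℕ.* y) % n) (toℕ-[] m) (toℕ-[] k))))

  0%n≡0 : 0 % n ≡ 0
  0%n≡0 = m<n⇒m%n≡m (ℕ.>-nonZero⁻¹ n)

  [n]≡[0] : [ n ] ≡ [ 0 ]
  [n]≡[0] = []-cong-% (trans (n%n≡0 n) (sym 0%n≡0))

  []≡[0]⇒%≡0 : ∀ {m} → [ m ] ≡ [ 0 ] → m % n ≡ 0
  []≡[0]⇒%≡0 {m} e = begin
    m % n        ≡⟨ toℕ-[] m ⟨
    toℕ [ m ]    ≡⟨ cong toℕ e ⟩
    toℕ [ 0 ]    ≡⟨ toℕ-[] 0 ⟩
    0 % n        ≡⟨ 0%n≡0 ⟩
    0            ∎

  []≡[0]⇒≡0 : ∀ {m} → m < n → [ m ] ≡ [ 0 ] → m ≡ 0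
  []≡[0]⇒≡0 m<n e = trans (sym (m<n⇒m%n≡m m<n)) ([]≡[0]⇒%≡0 e)

  []≡[0]⇒∣ : ∀ {m} → [ m ] ≡ [ 0 ] → n ∣ m
  []≡[0]⇒∣ {m} e = m%n≡0⇒n∣m m n ([]≡[0]⇒%≡0 e)

  -- The ring Z_n

  private
    +ₙ-comm : ∀ u v → u +ₙ v ≡ v +ₙ u
    +ₙ-comm u v = cong [_] (ℕₚ.+-comm (toℕ u) (toℕ v))

    *ₙ-comm : ∀ u v → u *ₙ v ≡ v *ₙ u
    *ₙ-comm u v = cong [_] (ℕₚ.*-comm (toℕ u) (toℕ v))

    +ₙ-assoc : ∀ u v w → (u +ₙ v) +ₙ w ≡ u +ₙ (v +ₙ w)
    +ₙ-assoc u v w = begin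
      [ toℕ u ℕ.+ toℕ v ] +ₙ w            ≡⟨ cong ([ toℕ u ℕ.+ toℕ v ] +ₙ_) ([toℕ] w) ⟨
      [ toℕ u ℕ.+ toℕ v ] +ₙ [ toℕ w ]   ≡⟨ []-+ (toℕ u ℕ.+ toℕ v) (toℕ w) ⟨
      [ toℕ u ℕ.+ toℕ v ℕ.+ toℕ w ]      ≡⟨ cong [_] (ℕₚ.+-assoc (toℕ u) (toℕ v) (toℕ w)) ⟩
      [ toℕ u ℕ.+ (toℕ v ℕ.+ toℕ w) ]    ≡⟨ []-+ (toℕ u) (toℕ v ℕ.+ toℕ w) ⟩
      [ toℕ u ] +ₙ (v +ₙ w)              ≡⟨ cong (_+ₙ (v +ₙ w)) ([toℕ] u) ⟩
      u +ₙ (v +ₙ w)                      ∎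

    *ₙ-assoc : ∀ u v w → (u *ₙ v) *ₙ w ≡ u *ₙ (v *ₙ w)
    *ₙ-assoc u v w = begin
      [ toℕ u ℕ.* toℕ v ] *ₙ w            ≡⟨ cong ([ toℕ u ℕ.* toℕ v ] *ₙ_) ([toℕ] w) ⟨
      [ toℕ u ℕ.* toℕ v ] *ₙ [ toℕ w ]   ≡⟨ []-* (toℕ u ℕ.* toℕ v) (toℕ w) ⟨
      [ toℕ u ℕ.* toℕ v ℕ.* toℕ w ]      ≡⟨ cong [_] (ℕₚ.*-assoc (toℕ u) (toℕ v) (toℕ w)) ⟩
      [ toℕ u ℕ.* (toℕ v ℕ.* toℕ w) ]    ≡⟨ []-* (toℕ u) (toℕ v ℕ.* toℕ w) ⟩
      [ toℕ u ] *ₙ (v *ₙ w)              ≡⟨ cong (_*ₙ (v *ₙ w)) ([toℕ] u) ⟩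
      u *ₙ (v *ₙ w)                      ∎

    +ₙ-identityˡ : ∀ u → [ 0 ] +ₙ u ≡ u
    +ₙ-identityˡ u = begin
      [ 0 ] +ₙ u          ≡⟨ cong ([ 0 ] +ₙ_) ([toℕ] u) ⟨
      [ 0 ] +ₙ [ toℕ u ]  ≡⟨ []-+ 0 (toℕ u) ⟨
      [ toℕ u ]           ≡⟨ [toℕ] u ⟩
      u                   ∎

    *ₙ-identityˡ : ∀ u → oneₙ *ₙ u ≡ u
    *ₙ-identityˡ u = begin
      [ 1 ] *ₙ u          ≡⟨ cong ([ 1 ] *ₙ_) ([toℕ] u) ⟨
      [ 1 ] *ₙ [ toℕ u ]  ≡⟨ []-* 1 (toℕ u) ⟨
      [ 1 ℕ.* toℕ u ]     ≡⟨ cong [_] (ℕₚ.*-identityˡ (toℕ u)) ⟩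
      [ toℕ u ]           ≡⟨ [toℕ] u ⟩
      u                   ∎

    -ₙ-inverseˡ : ∀ u → (-ₙ u) +ₙ u ≡ [ 0 ]
    -ₙ-inverseˡ u = begin
      [ n ℕ.∸ toℕ u ] +ₙ u          ≡⟨ cong ([ n ℕ.∸ toℕ u ] +ₙ_) ([toℕ] u) ⟨
      [ n ℕ.∸ toℕ u ] +ₙ [ toℕ u ]  ≡⟨ []-+ (n ℕ.∸ toℕ u) (toℕ u) ⟨
      [ n ℕ.∸ toℕ u ℕ.+ toℕ u ]     ≡⟨ cong [_] (ℕₚ.m∸n+n≡m (ℕₚ.<⇒≤ (Finₚ.toℕ<n u))) ⟩
      [ n ]                         ≡⟨ [n]≡[0] ⟩
      [ 0 ]                         ∎

    *ₙ-distribʳ-+ₙ : ∀ u v w → (v +ₙ w) *ₙ u ≡ (v *ₙ u) +ₙ (w *ₙ u)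
    *ₙ-distribʳ-+ₙ u v w = begin
      [ toℕ v ℕ.+ toℕ w ] *ₙ u                ≡⟨ cong ([ toℕ v ℕ.+ toℕ w ] *ₙ_) ([toℕ] u) ⟨
      [ toℕ v ℕ.+ toℕ w ] *ₙ [ toℕ u ]        ≡⟨ []-* (toℕ v ℕ.+ toℕ w) (toℕ u) ⟨
      [ (toℕ v ℕ.+ toℕ w) ℕ.* toℕ u ]         ≡⟨ cong [_] (ℕₚ.*-distribʳ-+ (toℕ u) (toℕ v) (toℕ w)) ⟩
      [ toℕ v ℕ.* toℕ u ℕ.+ toℕ w ℕ.* toℕ u ] ≡⟨ []-+ (toℕ v ℕ.* toℕ u) (toℕ w ℕ.* toℕ u) ⟩
      (v *ₙ u) +ₙ (w *ₙ u)                     ∎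

  isCommutativeRing : IsCommutativeRing _≡_ _+ₙ_ _*ₙ_ (-ₙ_) [ 0 ] oneₙ
  isCommutativeRing = record
    { isRing = record
      { +-isAbelianGroup = record
        { isGroup = record
          { isMonoid = record
            { isSemigroup = record { isMagma = isMagma _+ₙ_ ; assoc = +ₙ-assoc }
            ; identity    = comm∧idˡ⇒id +ₙ-comm +ₙ-identityˡ
            }
          ; inverse = comm∧invˡ⇒inv +ₙ-comm -ₙ-inverseˡ
          ; ⁻¹-cong = cong (-ₙ_)
          }
        ; comm = +ₙ-comm
        }
      ; *-cong     = cong₂ _*ₙ_
      ; *-assoc    = *ₙ-assoc
      ; *-identity = comm∧idˡ⇒id *ₙ-comm *ₙ-identityˡ
      ; distrib    = comm∧distrʳ⇒distrˡ *ₙ-comm *ₙ-distribʳ-+ₙ , *ₙ-distribʳ-+ₙ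
      }
    ; *-comm = *ₙ-comm
    }

  commutativeRing : CommutativeRing _ _
  commutativeRing = record { isCommutativeRing = isCommutativeRing }

  open CommutativeRing commutativeRing public
    using (_+_; _*_; -_; _-_; 0#; 1#; ring; +-comm; +-assoc; *-assoc;
           +-identityˡ; +-identityʳ; *-identityˡ; -‿inverseʳ; zeroˡ)
  open RingProperties ring public
    using (-1*x≈-x; -0#≈0#; -‿involutive; -‿+-comm; -‿distribˡ-*; -‿distribʳ-*; ⁻¹-anti-homo‿-;
           +-cancelˡ; +-cancelʳ; +-inverseˡ-unique; x∙y⁻¹≈ε⇒x≈y)

  infixr 8 _◃ₙ_
  _◃ₙ_ : Sign → Fin n → Fin n
  Sign.+ ◃ₙ u = u
  Sign.- ◃ₙ u = - u

  ◃ₙ-* : ∀ s s′ u v → (s ◃ₙ u) * (s′ ◃ₙ v) ≡ (s Sign.* s′) ◃ₙ (u * v)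
  ◃ₙ-* Sign.+ Sign.+ u v = refl
  ◃ₙ-* Sign.+ Sign.- u v = sym (-‿distribʳ-* u v)
  ◃ₙ-* Sign.- Sign.+ u v = sym (-‿distribˡ-* u v)
  ◃ₙ-* Sign.- Sign.- u v = begin
    - u * - v      ≡⟨ -‿distribˡ-* u (- v) ⟨
    - (u * - v)    ≡⟨ cong -_ (-‿distribʳ-* u v) ⟨
    - - (u * v)    ≡⟨ -‿involutive (u * v) ⟩
    u * v          ∎

  ◃ₙ-opposite : ∀ s u → Sign.opposite s ◃ₙ u ≡ - (s ◃ₙ u)
  ◃ₙ-opposite Sign.+ u = refl
  ◃ₙ-opposite Sign.- u = sym (-‿involutive u)

  []-∸ : ∀ {m k} → k ≤ m → [ m ℕ.∸ k ] ≡ [ m ] - [ k ]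
  []-∸ {m} {k} k≤m = begin
    [ m ℕ.∸ k ]                     ≡⟨ +-identityʳ _ ⟨
    [ m ℕ.∸ k ] + 0#                ≡⟨ cong (λ z → [ m ℕ.∸ k ] + z) (-‿inverseʳ [ k ]) ⟨
    [ m ℕ.∸ k ] + ([ k ] - [ k ])   ≡⟨ +-assoc [ m ℕ.∸ k ] [ k ] (- [ k ]) ⟨
    [ m ℕ.∸ k ] + [ k ] - [ k ]     ≡⟨ cong (_- [ k ]) ([]-+ (m ℕ.∸ k) k) ⟨
    [ m ℕ.∸ k ℕ.+ k ] - [ k ]       ≡⟨ cong (λ x → [ x ] - [ k ]) (ℕₚ.m∸n+n≡m k≤m) ⟩
    [ m ] - [ k ]                   ∎

  -- The solver gets integer coefficients: with Z_n itself as coefficient ring it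
  -- could not decide when a coefficient vanishes, since n is a variable.

  ⟦_⟧ℤ : ℤ → Fin n
  ⟦ ℤ.+ m ⟧ℤ    = [ m ]
  ⟦ -[1+ m ] ⟧ℤ = - [ suc m ]

  private
    ⟦⟧ℤ-neg : ∀ z → ⟦ ℤ.- z ⟧ℤ ≡ - ⟦ z ⟧ℤ
    ⟦⟧ℤ-neg (ℤ.+ zero)  = sym -0#≈0#
    ⟦⟧ℤ-neg (ℤ.+ suc m) = refl
    ⟦⟧ℤ-neg -[1+ m ]    = sym (-‿involutive [ suc m ])

    ⟦⟧ℤ-⊖ : ∀ m k → ⟦ m ⊖ k ⟧ℤ ≡ [ m ] - [ k ]
    ⟦⟧ℤ-⊖ m k with ℕₚ.≤-<-connex k m
    ... | inj₁ k≤m = trans (cong ⟦_⟧ℤ (ℤₚ.⊖-≥ k≤m)) ([]-∸ k≤m)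
    ... | inj₂ m<k = begin
      ⟦ m ⊖ k ⟧ℤ               ≡⟨ cong ⟦_⟧ℤ (ℤₚ.⊖-< m<k) ⟩
      ⟦ ℤ.- ℤ.+ (k ℕ.∸ m) ⟧ℤ   ≡⟨ ⟦⟧ℤ-neg (ℤ.+ (k ℕ.∸ m)) ⟩
      - [ k ℕ.∸ m ]            ≡⟨ cong -_ ([]-∸ (ℕₚ.<⇒≤ m<k)) ⟩
      - ([ k ] - [ m ])        ≡⟨ ⁻¹-anti-homo‿- [ k ] [ m ] ⟩
      [ m ] - [ k ]            ∎

    ⟦⟧ℤ-+ : ∀ x y → ⟦ x ℤ.+ y ⟧ℤ ≡ ⟦ x ⟧ℤ + ⟦ y ⟧ℤ
    ⟦⟧ℤ-+ -[1+ m ] -[1+ k ] = begin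
      - [ suc (suc (m ℕ.+ k)) ]      ≡⟨ cong (λ x → - [ suc x ]) (ℕₚ.+-suc m k) ⟨
      - [ suc m ℕ.+ suc k ]          ≡⟨ cong -_ ([]-+ (suc m) (suc k)) ⟩
      - ([ suc m ] + [ suc k ])      ≡⟨ -‿+-comm [ suc m ] [ suc k ] ⟨
      - [ suc m ] + - [ suc k ]      ∎
    ⟦⟧ℤ-+ -[1+ m ] (ℤ.+ k)  = trans (⟦⟧ℤ-⊖ k (suc m)) (+-comm [ k ] (- [ suc m ]))
    ⟦⟧ℤ-+ (ℤ.+ m)  -[1+ k ] = ⟦⟧ℤ-⊖ m (suc k)
    ⟦⟧ℤ-+ (ℤ.+ m)  (ℤ.+ k)  = []-+ m k

    ⟦⟧ℤ-◃ : ∀ s m → ⟦ s ℤ.◃ m ⟧ℤ ≡ s ◃ₙ [ m ]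
    ⟦⟧ℤ-◃ Sign.+ zero    = refl
    ⟦⟧ℤ-◃ Sign.- zero    = sym -0#≈0#
    ⟦⟧ℤ-◃ Sign.+ (suc m) = refl
    ⟦⟧ℤ-◃ Sign.- (suc m) = refl

    ⟦⟧ℤ-sign-abs : ∀ z → ⟦ z ⟧ℤ ≡ ℤ.sign z ◃ₙ [ ℤ.∣ z ∣ ]
    ⟦⟧ℤ-sign-abs (ℤ.+ m)  = refl
    ⟦⟧ℤ-sign-abs -[1+ m ] = refl

    ⟦⟧ℤ-* : ∀ x y → ⟦ x ℤ.* y ⟧ℤ ≡ ⟦ x ⟧ℤ * ⟦ y ⟧ℤ
    ⟦⟧ℤ-* x y = begin
      ⟦ (sx Sign.* sy) ℤ.◃ (ax ℕ.* ay) ⟧ℤ   ≡⟨ ⟦⟧ℤ-◃ (sx Sign.* sy) (ax ℕ.* ay) ⟩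
      (sx Sign.* sy) ◃ₙ [ ax ℕ.* ay ]        ≡⟨ cong ((sx Sign.* sy) ◃ₙ_) ([]-* ax ay) ⟩
      (sx Sign.* sy) ◃ₙ ([ ax ] * [ ay ])    ≡⟨ ◃ₙ-* sx sy [ ax ] [ ay ] ⟨
      (sx ◃ₙ [ ax ]) * (sy ◃ₙ [ ay ])       ≡⟨ cong₂ _*_ (⟦⟧ℤ-sign-abs x) (⟦⟧ℤ-sign-abs y) ⟨
      ⟦ x ⟧ℤ * ⟦ y ⟧ℤ                       ∎
      where
      sx sy : Sign
      sx = ℤ.sign x
      sy = ℤ.sign y
      ax ay : ℕ
      ax = ℤ.∣ x ∣
      ay = ℤ.∣ y ∣

  ℤ⟶Zₙ : ℤ.+-*-rawRing -Raw-AlmostCommutative⟶ fromCommutativeRing commutativeRing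
  ℤ⟶Zₙ = record
    { ⟦_⟧    = ⟦_⟧ℤ
    ; +-homo = ⟦⟧ℤ-+
    ; *-homo = ⟦⟧ℤ-*
    ; -‿homo = ⟦⟧ℤ-neg
    ; 0-homo = refl
    ; 1-homo = refl
    }

  open RingSolver ℤ.+-*-rawRing (fromCommutativeRing commutativeRing) ℤ⟶Zₙ
    (λ x y → Maybe.map (cong ⟦_⟧ℤ) (dec⇒maybe (x ℤ.≟ y)))
    public using (solve; _:=_; con; _:+_; _:*_; _:-_; :-_)

  opposite≡-[1+] : ∀ u → opposite u ≡ - (1# + u)
  opposite≡-[1+] u = +-inverseˡ-unique (opposite u) (1# + u) (begin
    opposite u + (1# + u)                    ≡⟨ cong (λ w → opposite u + (1# + w)) ([toℕ] u) ⟨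
    opposite u + ([ 1 ] + [ toℕ u ])         ≡⟨ cong (opposite u +_) ([]-+ 1 (toℕ u)) ⟨
    opposite u + [ suc (toℕ u) ]             ≡⟨ cong (_+ [ suc (toℕ u) ]) ([toℕ] (opposite u)) ⟨
    [ toℕ (opposite u) ] + [ suc (toℕ u) ]   ≡⟨ []-+ (toℕ (opposite u)) (suc (toℕ u)) ⟨
    [ toℕ (opposite u) ℕ.+ suc (toℕ u) ]     ≡⟨ cong (λ m → [ m ℕ.+ suc (toℕ u) ]) (Finₚ.opposite-prop u) ⟩
    [ n ℕ.∸ suc (toℕ u) ℕ.+ suc (toℕ u) ]    ≡⟨ cong [_] (ℕₚ.m∸n+n≡m (Finₚ.toℕ<n u)) ⟩
    [ n ]                                    ≡⟨ [n]≡[0] ⟩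
    0#                                       ∎)

  opposite-injective : Injective _≡_ _≡_ (opposite {n})
  opposite-injective {u} {v} e =
    trans (sym (Finₚ.opposite-involutive u)) (trans (cong opposite e) (Finₚ.opposite-involutive v))

  -ʳ-injective : ∀ k → Injective _≡_ _≡_ (_- k)
  -ʳ-injective k {u} {v} = +-cancelʳ (- k) u v

  quarterTurn-from-axes : ∀ {a b k₁ k₂ T σ} → σ * σ ≡ 1# →
    k₁ * a ≡ 1# + T → k₁ * b ≡ σ * T → k₂ * a ≡ - (σ * T) → k₂ * b ≡ 1# + T →
    ∃ λ m → m * a ≡ - b × m * b ≡ a
  quarterTurn-from-axes {a} {b} {k₁} {k₂} {T} {σ} σσ≡1 k₁a≡ k₁b≡ k₂a≡ k₂b≡ =
    U * k₂ , U*k₂*a≡-b , U*k₂*b≡a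
    where
    U : Fin n
    U = a - σ * b
    Uk₁≡1 : U * k₁ ≡ 1#
    Uk₁≡1 = begin
      (a - σ * b) * k₁
        ≡⟨ solve 4 (λ a b σ k → (a :- σ :* b) :* k := k :* a :- σ :* (k :* b)) refl a b σ k₁ ⟩
      k₁ * a - σ * (k₁ * b)     ≡⟨ cong₂ (λ x y → x - σ * y) k₁a≡ k₁b≡ ⟩
      1# + T - σ * (σ * T)      ≡⟨ cong (λ z → 1# + T - z) (*-assoc σ σ T) ⟨
      1# + T - σ * σ * T        ≡⟨ cong (λ z → 1# + T - z * T) σσ≡1 ⟩
      1# + T - 1# * T           ≡⟨ solve 1 (λ T → con (ℤ.+ 1) :+ T :- con (ℤ.+ 1) :* T := con (ℤ.+ 1)) refl T ⟩
      1#                        ∎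
    rescale : ∀ x → U * (k₁ * x) ≡ x
    rescale x = begin
      U * (k₁ * x)   ≡⟨ *-assoc U k₁ x ⟨
      U * k₁ * x     ≡⟨ cong (_* x) Uk₁≡1 ⟩
      1# * x         ≡⟨ *-identityˡ x ⟩
      x              ∎
    U*k₂*a≡-b : U * k₂ * a ≡ - b
    U*k₂*a≡-b = begin
      U * k₂ * a         ≡⟨ *-assoc U k₂ a ⟩
      U * (k₂ * a)       ≡⟨ cong (U *_) k₂a≡ ⟩
      U * - (σ * T)      ≡⟨ -‿distribʳ-* U (σ * T) ⟨
      - (U * (σ * T))    ≡⟨ cong (λ z → - (U * z)) k₁b≡ ⟨
      - (U * (k₁ * b))   ≡⟨ cong -_ (rescale b) ⟩
      - b                ∎
    U*k₂*b≡a : U * k₂ * b ≡ a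
    U*k₂*b≡a = begin
      U * k₂ * b         ≡⟨ *-assoc U k₂ b ⟩
      U * (k₂ * b)       ≡⟨ cong (U *_) (trans k₂b≡ (sym k₁a≡)) ⟩
      U * (k₁ * a)       ≡⟨ rescale a ⟩
      a                  ∎

  ◃ₙ-as-* : ∀ s u → s ◃ₙ u ≡ (s ◃ₙ 1#) * u
  ◃ₙ-as-* Sign.+ u = sym (*-identityˡ u)
  ◃ₙ-as-* Sign.- u = sym (-1*x≈-x u)

  ◃ₙ-1#-squared : ∀ s → (s ◃ₙ 1#) * (s ◃ₙ 1#) ≡ 1#
  ◃ₙ-1#-squared s = begin
    (s ◃ₙ 1#) * (s ◃ₙ 1#)       ≡⟨ ◃ₙ-* s s 1# 1# ⟩
    (s Sign.* s) ◃ₙ (1# * 1#)   ≡⟨ cong (_◃ₙ (1# * 1#)) (Signₚ.s*s≡+ s) ⟩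
    1# * 1#                     ≡⟨ *-identityˡ 1# ⟩
    1#                          ∎

  x-u≡y⇒u≡x-y : ∀ x u {y} → x - u ≡ y → u ≡ x - y
  x-u≡y⇒u≡x-y x u e =
    trans (solve 2 (λ x u → u := x :- (x :- u)) refl x u) (cong (λ z → x - z) e)

  det-multiples≡0 : ∀ a b k₁ k₂ → k₁ * a * (k₂ * b) - k₁ * b * (k₂ * a) ≡ 0#
  det-multiples≡0 = solve 4 (λ a b k₁ k₂ → k₁ :* a :* (k₂ :* b) :- k₁ :* b :* (k₂ :* a) := con (ℤ.+ 0)) refl

  -- Lee weight

  private
    leeℕ : ℕ → ℕ
    leeℕ m = m ℕ.⊓ (n ℕ.∸ m)

    leeℕ-complement : ∀ {m} → m < n → leeℕ ((n ℕ.∸ m) % n) ≡ leeℕ m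
    leeℕ-complement {zero}  _   = cong leeℕ (n%n≡0 n)
    leeℕ-complement {suc m} m<n = begin
      leeℕ ((n ℕ.∸ suc m) % n)                           ≡⟨ cong leeℕ (m<n⇒m%n≡m n∸m<n) ⟩
      (n ℕ.∸ suc m) ℕ.⊓ (n ℕ.∸ (n ℕ.∸ suc m))
        ≡⟨ cong ((n ℕ.∸ suc m) ℕ.⊓_) (ℕₚ.m∸[m∸n]≡n (ℕₚ.<⇒≤ m<n)) ⟩
      (n ℕ.∸ suc m) ℕ.⊓ suc m                            ≡⟨ ℕₚ.⊓-comm (n ℕ.∸ suc m) (suc m) ⟩
      leeℕ (suc m)                                       ∎
      where
      n∸m<n : n ℕ.∸ suc m < n
      n∸m<n = ℕₚ.∸-monoʳ-< {n} {suc m} {0} (s≤s z≤n) (ℕₚ.<⇒≤ m<n)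

  leeEntry-neg : ∀ u → leeEntry (- u) ≡ leeEntry u
  leeEntry-neg u = trans (cong leeℕ (toℕ-[] (n ℕ.∸ toℕ u))) (leeℕ-complement (Finₚ.toℕ<n u))

  leeEntry-0#- : ∀ u → leeEntry (0# - u) ≡ leeEntry u
  leeEntry-0#- u = trans (cong leeEntry (+-identityˡ (- u))) (leeEntry-neg u)

  leeEntry-signed : ∀ u → ∃ λ s → u ≡ s ◃ₙ [ leeEntry u ]
  leeEntry-signed u with ℕₚ.≤-total (toℕ u) (n ℕ.∸ toℕ u)
  ... | inj₁ u≤n∸u = Sign.+ , (begin
    u                  ≡⟨ [toℕ] u ⟨
    [ toℕ u ]          ≡⟨ cong [_] (ℕₚ.m≤n⇒m⊓n≡m u≤n∸u) ⟨
    [ leeEntry u ]     ∎)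
  ... | inj₂ n∸u≤u = Sign.- , (begin
    u                        ≡⟨ solve 1 (λ u → u := :- (con (ℤ.+ 0) :- u)) refl u ⟩
    - (0# - u)               ≡⟨ cong (λ w → - (w - u)) [n]≡[0] ⟨
    - ([ n ] - u)            ≡⟨ cong (λ w → - ([ n ] - w)) ([toℕ] u) ⟨
    - ([ n ] - [ toℕ u ])    ≡⟨ cong -_ ([]-∸ (ℕₚ.<⇒≤ (Finₚ.toℕ<n u))) ⟨
    - [ n ℕ.∸ toℕ u ]        ≡⟨ cong (λ m → - [ m ]) (ℕₚ.m≥n⇒m⊓n≡n n∸u≤u) ⟨
    - [ leeEntry u ]         ∎)

  leeEntry-◃ₙ-≤ : ∀ s m → leeEntry (s ◃ₙ [ m ]) ≤ m
  leeEntry-◃ₙ-≤ Sign.+ m = ℕₚ.≤-trans (ℕₚ.m⊓n≤m (toℕ [ m ]) _)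
    (subst (_≤ m) (sym (toℕ-[] m)) (m%n≤m m n))
  leeEntry-◃ₙ-≤ Sign.- m = subst (_≤ m) (sym (leeEntry-neg [ m ])) (leeEntry-◃ₙ-≤ Sign.+ m)

  -- Symmetries of codes

  private
    [x+u]-x≡u : ∀ x u → (x + u) - x ≡ u
    [x+u]-x≡u = solve 2 (λ x u → (x :+ u) :- x := u) refl

    x+[u-x]≡u : ∀ x u → x + (u - x) ≡ u
    x+[u-x]≡u = solve 2 (λ x u → x :+ (u :- x) := u) refl

    [x+u]-[x+v]≡u-v : ∀ x u v → (x + u) - (x + v) ≡ u - v
    [x+u]-[x+v]≡u-v = solve 3 (λ x u v → (x :+ u) :- (x :+ v) := u :- v) refl

    [u-x]-[v-x]≡u-v : ∀ x u v → (u - x) - (v - x) ≡ u - v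
    [u-x]-[v-x]≡u-v = solve 3 (λ x u v → (u :- x) :- (v :- x) := u :- v) refl

  [x+p]-x≡p : ∀ x p → (x +ᵖ p) -ᵖ x ≡ p
  [x+p]-x≡p (x₁ , x₂) (p₁ , p₂) = cong₂ _,_ ([x+u]-x≡u x₁ p₁) ([x+u]-x≡u x₂ p₂)

  x+[p-x]≡p : ∀ x p → x +ᵖ (p -ᵖ x) ≡ p
  x+[p-x]≡p (x₁ , x₂) (p₁ , p₂) = cong₂ _,_ (x+[u-x]≡u x₁ p₁) (x+[u-x]≡u x₂ p₂)

  dL-+ᵖ-invariant : ∀ x p q → dL (x +ᵖ p) (x +ᵖ q) ≡ dL p q
  dL-+ᵖ-invariant (x₁ , x₂) (p₁ , p₂) (q₁ , q₂) = cong₂ ℕ._+_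
    (cong leeEntry ([x+u]-[x+v]≡u-v x₁ p₁ q₁)) (cong leeEntry ([x+u]-[x+v]≡u-v x₂ p₂ q₂))

  dL--ᵖ-invariant : ∀ x p q → dL (p -ᵖ x) (q -ᵖ x) ≡ dL p q
  dL--ᵖ-invariant (x₁ , x₂) (p₁ , p₂) (q₁ , q₂) = cong₂ ℕ._+_
    (cong leeEntry ([u-x]-[v-x]≡u-v x₁ p₁ q₁)) (cong leeEntry ([u-x]-[v-x]≡u-v x₂ p₂ q₂))

  record CodeSymmetry (C : Code {n}) : Set where
    field
      to from    : Pt {n} → Pt {n}
      from-to    : ∀ p → from (to p) ≡ p
      to-from    : ∀ p → to (from p) ≡ p
      isometry   : ∀ p q → dL (to p) (to q) ≡ dL p q
      to-closed   : ∀ {p} → C p → C (to p)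
      from-closed : ∀ {p} → C p → C (from p)

    to-injective : Injective _≡_ _≡_ to
    to-injective {p} {q} e = trans (sym (from-to p)) (trans (cong from e) (from-to q))

    from-injective : Injective _≡_ _≡_ from
    from-injective {p} {q} e = trans (sym (to-from p)) (trans (cong to e) (to-from q))

  open CodeSymmetry

  inverse : ∀ {C} → CodeSymmetry C → CodeSymmetry C
  inverse σ = record
    { to          = from σ
    ; from        = to σ
    ; from-to     = to-from σ
    ; to-from     = from-to σ
    ; isometry    = λ p q → trans (sym (isometry σ (from σ p) (from σ q)))
                                  (cong₂ dL (to-from σ p) (to-from σ q))
    ; to-closed   = from-closed σ
    ; from-closed = to-closed σ
    }

  ≗-codeSymmetry : ∀ {C} (σ : CodeSymmetry C) (f g : Pt {n} → Pt {n}) →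
                   f ≗ to σ → g ≗ from σ → CodeSymmetry C
  ≗-codeSymmetry {C} σ f g f≗to g≗from = record
    { to          = f
    ; from        = g
    ; from-to     = λ p → trans (g≗from (f p)) (trans (cong (from σ) (f≗to p)) (from-to σ p))
    ; to-from     = λ p → trans (f≗to (g p)) (trans (cong (to σ) (g≗from p)) (to-from σ p))
    ; isometry    = λ p q → trans (cong₂ dL (f≗to p) (f≗to q)) (isometry σ p q)
    ; to-closed   = λ Cp → subst C (sym (f≗to _)) (to-closed σ Cp)
    ; from-closed = λ Cp → subst C (sym (g≗from _)) (from-closed σ Cp)
    }

  conjugate : ∀ {C₀ : Code {n}} x → CodeSymmetry C₀ → CodeSymmetry (translate x C₀)
  conjugate {C₀} x σ = record
    { to          = λ p → x +ᵖ to σ (p -ᵖ x)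
    ; from        = λ p → x +ᵖ from σ (p -ᵖ x)
    ; from-to     = λ p → cancel (from σ) (to σ) (from-to σ) p
    ; to-from     = λ p → cancel (to σ) (from σ) (to-from σ) p
    ; isometry    = λ p q → begin
        dL (x +ᵖ to σ (p -ᵖ x)) (x +ᵖ to σ (q -ᵖ x))   ≡⟨ dL-+ᵖ-invariant x _ _ ⟩
        dL (to σ (p -ᵖ x)) (to σ (q -ᵖ x))             ≡⟨ isometry σ (p -ᵖ x) (q -ᵖ x) ⟩
        dL (p -ᵖ x) (q -ᵖ x)                           ≡⟨ dL--ᵖ-invariant x p q ⟩
        dL p q                                         ∎
    ; to-closed   = closed (to σ) (to-closed σ)
    ; from-closed = closed (from σ) (from-closed σ)
    }
    where
    cancel : ∀ f g → (∀ p → f (g p) ≡ p) → ∀ p → x +ᵖ f ((x +ᵖ g (p -ᵖ x)) -ᵖ x) ≡ p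
    cancel f g fg p = begin
      x +ᵖ f ((x +ᵖ g (p -ᵖ x)) -ᵖ x)   ≡⟨ cong (λ q → x +ᵖ f q) ([x+p]-x≡p x (g (p -ᵖ x))) ⟩
      x +ᵖ f (g (p -ᵖ x))               ≡⟨ cong (x +ᵖ_) (fg (p -ᵖ x)) ⟩
      x +ᵖ (p -ᵖ x)                     ≡⟨ x+[p-x]≡p x p ⟩
      p                                 ∎
    closed : ∀ f → (∀ {c} → C₀ c → C₀ (f c)) →
             ∀ {p} → translate x C₀ p → translate x C₀ (x +ᵖ f (p -ᵖ x))
    closed f f-closed (c , C₀c , refl) = f c , f-closed C₀c , cong (λ q → x +ᵖ f q) ([x+p]-x≡p x c)

  module _ {a b : Fin n} where

    genCode-translation : CodeSymmetry (genCode a b)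
    genCode-translation = record
      { to          = _-ᵖ (a , b)
      ; from        = _+ᵖ (a , b)
      ; from-to     = λ (u , v) → cong₂ _,_ (u-a+a≡u u a) (u-a+a≡u v b)
      ; to-from     = λ (u , v) → cong₂ _,_ (u+a-a≡u u a) (u+a-a≡u v b)
      ; isometry    = dL--ᵖ-invariant (a , b)
      ; to-closed   = λ { (k , refl) → k - 1# , cong₂ _,_ (ka-a≡[k-1]a k a) (ka-a≡[k-1]a k b) }
      ; from-closed = λ { (k , refl) → k + 1# , cong₂ _,_ (ka+a≡[k+1]a k a) (ka+a≡[k+1]a k b) }
      }
      where
      u-a+a≡u : ∀ u a → u - a + a ≡ u
      u-a+a≡u = solve 2 (λ u a → u :- a :+ a := u) refl
      u+a-a≡u : ∀ u a → u + a - a ≡ u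
      u+a-a≡u = solve 2 (λ u a → u :+ a :- a := u) refl
      ka-a≡[k-1]a : ∀ k a → k * a - a ≡ (k - 1#) * a
      ka-a≡[k-1]a = solve 2 (λ k a → k :* a :- a := (k :- con (ℤ.+ 1)) :* a) refl
      ka+a≡[k+1]a : ∀ k a → k * a + a ≡ (k + 1#) * a
      ka+a≡[k+1]a = solve 2 (λ k a → k :* a :+ a := (k :+ con (ℤ.+ 1)) :* a) refl

    genCode-quarterTurn : ∀ m → m * a ≡ - b → m * b ≡ a → CodeSymmetry (genCode a b)
    genCode-quarterTurn m ma≡-b mb≡a = record
      { to          = λ (u , v) → - v , u
      ; from        = λ (u , v) → v , - u
      ; from-to     = λ (u , v) → cong (u ,_) (-‿involutive v)
      ; to-from     = λ (u , v) → cong (_, v) (-‿involutive u)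
      ; isometry    = λ (u , v) (u′ , v′) → trans
          (cong (ℕ._+ leeEntry (u - u′)) (trans (cong leeEntry (-u+v≡-[u-v] v v′)) (leeEntry-neg (v - v′))))
          (ℕₚ.+-comm (leeEntry (v - v′)) (leeEntry (u - u′)))
      ; to-closed   = λ { (k , refl) → k * m , cong₂ _,_ (sym (km·a≡-kb k)) (sym (km·b≡ka k)) }
      ; from-closed = λ { (k , refl) → - (k * m) , cong₂ _,_ (sym (-km·a≡kb k)) (sym (-km·b≡-ka k)) }
      }
      where
      -u+v≡-[u-v] : ∀ u v → - u - - v ≡ - (u - v)
      -u+v≡-[u-v] = solve 2 (λ u v → :- u :- :- v := :- (u :- v)) refl
      km·a≡-kb : ∀ k → k * m * a ≡ - (k * b)
      km·a≡-kb k = begin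
        k * m * a     ≡⟨ *-assoc k m a ⟩
        k * (m * a)   ≡⟨ cong (k *_) ma≡-b ⟩
        k * - b       ≡⟨ -‿distribʳ-* k b ⟨
        - (k * b)     ∎
      km·b≡ka : ∀ k → k * m * b ≡ k * a
      km·b≡ka k = trans (*-assoc k m b) (cong (k *_) mb≡a)
      -km·a≡kb : ∀ k → - (k * m) * a ≡ k * b
      -km·a≡kb k = begin
        - (k * m) * a   ≡⟨ -‿distribˡ-* (k * m) a ⟨
        - (k * m * a)   ≡⟨ cong -_ (km·a≡-kb k) ⟩
        - - (k * b)     ≡⟨ -‿involutive (k * b) ⟩
        k * b           ∎
      -km·b≡-ka : ∀ k → - (k * m) * b ≡ - (k * a)
      -km·b≡-ka k = trans (sym (-‿distribˡ-* (k * m) b)) (cong -_ (km·b≡ka k))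

  -- The formulas for to and from are those of ⟦ g₂ ⟧, ⟦ g₂⁻¹ ⟧, ⟦ g₁ ⟧, ⟦ g₁⁻¹ ⟧, so that
  -- pulling back along them is definitionally the action of the generators.
  module _ (a b x₁ x₂ : Fin n) where

    translation-symmetry : CodeSymmetry (translate (x₁ , x₂) (genCode a b))
    translation-symmetry = ≗-codeSymmetry (conjugate (x₁ , x₂) genCode-translation)
      (λ (u , v) → u - a , v - b)
      (λ (u , v) → u - - a , v - - b)
      (λ (u , v) → cong₂ _,_ (u-a≡x+[[u-x]-a] x₁ u a) (u-a≡x+[[u-x]-a] x₂ v b))
      (λ (u , v) → cong₂ _,_ (u--a≡x+[[u-x]+a] x₁ u a) (u--a≡x+[[u-x]+a] x₂ v b))
      where
      u-a≡x+[[u-x]-a] : ∀ x u a → u - a ≡ x + (u - x - a)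
      u-a≡x+[[u-x]-a] = solve 3 (λ x u a → u :- a := x :+ (u :- x :- a)) refl
      u--a≡x+[[u-x]+a] : ∀ x u a → u - - a ≡ x + (u - x + a)
      u--a≡x+[[u-x]+a] = solve 3 (λ x u a → u :- :- a := x :+ (u :- x :+ a)) refl

    rotation-symmetry : ∀ m → m * a ≡ - b → m * b ≡ a →
                        CodeSymmetry (translate (x₁ , x₂) (genCode a b))
    rotation-symmetry m ma≡-b mb≡a =
      ≗-codeSymmetry (conjugate (x₁ , x₂) (genCode-quarterTurn m ma≡-b mb≡a))
        (λ (u , v) → opposite (v - (x₁ + x₂ + 1#)) , u - (x₁ - x₂))
        (λ (u , v) → v - - (x₁ - x₂) , opposite u - - (x₁ + x₂ + 1#))
        (λ (u , v) → cong₂ _,_ (trans (opposite≡-[1+] _) (to₁ x₁ x₂ v)) (to₂ x₁ x₂ u))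
        (λ (u , v) → cong₂ _,_ (from₁ x₁ x₂ v)
          (trans (cong (_- - (x₁ + x₂ + 1#)) (opposite≡-[1+] u)) (from₂ x₁ x₂ u)))
      where
      to₁ : ∀ x₁ x₂ v → - (1# + (v - (x₁ + x₂ + 1#))) ≡ x₁ + - (v - x₂)
      to₁ = solve 3 (λ x₁ x₂ v → :- (con (ℤ.+ 1) :+ (v :- (x₁ :+ x₂ :+ con (ℤ.+ 1))))
                                  := x₁ :+ :- (v :- x₂)) refl
      to₂ : ∀ x₁ x₂ u → u - (x₁ - x₂) ≡ x₂ + (u - x₁)
      to₂ = solve 3 (λ x₁ x₂ u → u :- (x₁ :- x₂) := x₂ :+ (u :- x₁)) refl
      from₁ : ∀ x₁ x₂ v → v - - (x₁ - x₂) ≡ x₁ + (v - x₂)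
      from₁ = solve 3 (λ x₁ x₂ v → v :- :- (x₁ :- x₂) := x₁ :+ (v :- x₂)) refl
      from₂ : ∀ x₁ x₂ u → - (1# + u) - - (x₁ + x₂ + 1#) ≡ x₂ + - (u - x₁)
      from₂ = solve 3 (λ x₁ x₂ u → :- (con (ℤ.+ 1) :+ u) :- :- (x₁ :+ x₂ :+ con (ℤ.+ 1))
                                    := x₂ :+ :- (u :- x₁)) refl

  -- Perfect Sudoku grids under symmetries

  pullback : (Pt {n} → Pt {n}) → Array → Array
  pullback f A i j = uncurry A (f (i , j))

  Latin-reindex : ∀ {A : Array {n}} {f g : Fin n → Fin n} → Injective _≡_ _≡_ f → Injective _≡_ _≡_ g →
                  Latin A → Latin (λ i j → A (f i) (g j))
  Latin-reindex f-injective g-injective (rows , columns) =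
    (λ i e → g-injective (rows _ e)) , (λ j e → f-injective (columns _ e))

  Latin-transpose : ∀ {A : Array {n}} → Latin A → Latin (λ i j → A j i)
  Latin-transpose (rows , columns) = columns , rows

  Orthogonal-pullback : ∀ {f : Pt {n} → Pt {n}} {A B} → Injective _≡_ _≡_ f →
                        Orthogonal A B → Orthogonal (pullback f A) (pullback f B)
  Orthogonal-pullback f-injective orthogonal i j i′ j′ eA eB =
    cong proj₁ same-cell , cong proj₂ same-cell
    where
    same-cell : (i , j) ≡ (i′ , j′)
    same-cell = f-injective (uncurry (cong₂ _,_) (orthogonal _ _ _ _ eA eB))

  IsPaletteGrid-pullback : ∀ {t C I} (σ : CodeSymmetry C) →
                           IsPaletteGrid t C I → IsPaletteGrid t C (pullback (to σ) I)
  IsPaletteGrid-pullback {t} {C} {I} σ (c , c-injective , c∈C , c-onto , c-ball) =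
    from σ ∘ c , (λ e → c-injective (from-injective σ e)) , from-closed σ ∘ c∈C , onto , ball
    where
    onto : ∀ p → C p → ∃ λ i → from σ (c i) ≡ p
    onto p Cp with c-onto (to σ p) (to-closed σ Cp)
    ... | i , ci≡σp = i , trans (cong (from σ) ci≡σp) (from-to σ p)
    ball : ∀ x y i → Ball t (from σ (c i)) (x , y) → pullback (to σ) I x y ≡ i
    ball x y i near = c-ball _ _ i (subst (_≤ t) (begin
      dL (x , y) (from σ (c i))                  ≡⟨ isometry σ (x , y) (from σ (c i)) ⟨
      dL (to σ (x , y)) (to σ (from σ (c i)))    ≡⟨ cong (dL (to σ (x , y))) (to-from σ (c i)) ⟩
      dL (to σ (x , y)) (c i)                    ∎) near)

  PerfectSudoku-pullback : ∀ {t C S} (σ : CodeSymmetry C) → PerfectSudoku t C S →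
                           Latin (pullback (to σ) S) → PerfectSudoku t C (pullback (to σ) S)
  PerfectSudoku-pullback σ (_ , I , palette , orthogonal) latin =
    latin , pullback (to σ) I , IsPaletteGrid-pullback σ palette ,
    Orthogonal-pullback (to-injective σ) orthogonal

-- Linear perfect codes are invariant under the quarter turn

cross-difference : ∀ {t₁ t₂ d d′ e e′} → d ℕ.+ d′ ≡ t₁ → e ℕ.+ e′ ≡ t₂ →
  (suc t₂ ℕ.+ d) ℕ.* (suc t₁ ℕ.+ e) ≡ d′ ℕ.* e′ ℕ.+ suc (t₁ ℕ.+ t₂) ℕ.* suc (d ℕ.+ e)
cross-difference {d = d} {d′} {e} {e′} refl refl = poly d d′ e e′
  where
  poly : ∀ d d′ e e′ → (suc (e ℕ.+ e′) ℕ.+ d) ℕ.* (suc (d ℕ.+ d′) ℕ.+ e)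
                     ≡ d′ ℕ.* e′ ℕ.+ suc (d ℕ.+ d′ ℕ.+ (e ℕ.+ e′)) ℕ.* suc (d ℕ.+ e)
  poly = solve-∀

-- t appears split both as d + d′ and as e + e′, so this is no polynomial identity
-- after substituting either; adding d′e to both sides lets e + e′ ≡ t be used once.
cross-sum : ∀ {t d d′ e e′} → d ℕ.+ d′ ≡ t → e ℕ.+ e′ ≡ t →
  (suc t ℕ.+ d) ℕ.* (suc t ℕ.+ e) ℕ.+ d′ ℕ.* e′ ≡ N t ℕ.+ (d ℕ.+ e ℕ.+ 2 ℕ.* (d ℕ.* e))
cross-sum {d = d} {d′} {e} {e′} refl he = ℕₚ.+-cancelʳ-≡ (d′ ℕ.* e) _ _ (begin
  X ℕ.+ d′ ℕ.* e′ ℕ.+ d′ ℕ.* e       ≡⟨ ℕₚ.+-assoc X (d′ ℕ.* e′) (d′ ℕ.* e) ⟩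
  X ℕ.+ (d′ ℕ.* e′ ℕ.+ d′ ℕ.* e)     ≡⟨ cong (X ℕ.+_) (ℕₚ.*-distribˡ-+ d′ e′ e) ⟨
  X ℕ.+ d′ ℕ.* (e′ ℕ.+ e)            ≡⟨ cong (λ z → X ℕ.+ d′ ℕ.* z) (trans (ℕₚ.+-comm e′ e) he) ⟩
  X ℕ.+ d′ ℕ.* (d ℕ.+ d′)            ≡⟨ poly d d′ e ⟩
  N (d ℕ.+ d′) ℕ.+ (d ℕ.+ e ℕ.+ 2 ℕ.* (d ℕ.* e)) ℕ.+ d′ ℕ.* e ∎)
  where
  open ≡-Reasoning
  X : ℕ
  X = (suc (d ℕ.+ d′) ℕ.+ d) ℕ.* (suc (d ℕ.+ d′) ℕ.+ e)
  poly : ∀ d d′ e → (suc (d ℕ.+ d′) ℕ.+ d) ℕ.* (suc (d ℕ.+ d′) ℕ.+ e) ℕ.+ d′ ℕ.* (d ℕ.+ d′)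
       ≡ suc (2 ℕ.* (d ℕ.+ d′) ℕ.* (d ℕ.+ d′) ℕ.+ 2 ℕ.* (d ℕ.+ d′))
         ℕ.+ (d ℕ.+ e ℕ.+ 2 ℕ.* (d ℕ.* e)) ℕ.+ d′ ℕ.* e
  poly = solve-∀

[2t+1]t+[t+1]≡N : ∀ t → suc (t ℕ.+ t) ℕ.* t ℕ.+ suc t ≡ suc (2 ℕ.* t ℕ.* t ℕ.+ 2 ℕ.* t)
[2t+1]t+[t+1]≡N = solve-∀

[2t+1][t+1]≡N+t : ∀ t → suc (t ℕ.+ t) ℕ.* suc t ≡ suc (2 ℕ.* t ℕ.* t ℕ.+ 2 ℕ.* t) ℕ.+ t
[2t+1][t+1]≡N+t = solve-∀

1+[2t+1]²≡2N : ∀ t → suc (suc (t ℕ.+ t) ℕ.* suc (t ℕ.+ t)) ≡ 2 ℕ.* suc (2 ℕ.* t ℕ.* t ℕ.+ 2 ℕ.* t)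
1+[2t+1]²≡2N = solve-∀

1+2t+2t²≡N : ∀ t → suc (t ℕ.+ t ℕ.+ 2 ℕ.* (t ℕ.* t)) ≡ suc (2 ℕ.* t ℕ.* t ℕ.+ 2 ℕ.* t)
1+2t+2t²≡N = solve-∀

2t+1≡suc[t+t] : ∀ t → 2 ℕ.* t ℕ.+ 1 ≡ suc (t ℕ.+ t)
2t+1≡suc[t+t] = solve-∀

module PerfectLeeCodes (t : ℕ) (1≤t : 1 ≤ t) where

  open Modular (N t)

  private
    [2t+1]t<N : suc (t ℕ.+ t) ℕ.* t < N t
    [2t+1]t<N = subst (suc (t ℕ.+ t) ℕ.* t <_) ([2t+1]t+[t+1]≡N t) (ℕₚ.m<m+n _ (s≤s z≤n))

    2t+1<N : suc (t ℕ.+ t) < N t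
    2t+1<N = ℕₚ.≤-<-trans (subst (_≤ suc (t ℕ.+ t) ℕ.* t) (ℕₚ.*-identityʳ (suc (t ℕ.+ t)))
                                 (ℕₚ.*-monoʳ-≤ (suc (t ℕ.+ t)) 1≤t))
                          [2t+1]t<N

    N<[2t+1][t+1] : N t < suc (t ℕ.+ t) ℕ.* suc t
    N<[2t+1][t+1] = subst (N t <_) (sym ([2t+1][t+1]≡N+t t))
      (subst (_≤ N t ℕ.+ t) (ℕₚ.+-comm (N t) 1) (ℕₚ.+-monoʳ-≤ (N t) 1≤t))

  odd-multiple≢N : ∀ m → suc (t ℕ.+ t) ℕ.* m ≢ N t
  odd-multiple≢N m with ℕₚ.≤-<-connex m t
  ... | inj₁ m≤t = ℕₚ.<⇒≢ (ℕₚ.≤-<-trans (ℕₚ.*-monoʳ-≤ (suc (t ℕ.+ t)) m≤t) [2t+1]t<N)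
  ... | inj₂ t<m = ℕₚ.>⇒≢ (ℕₚ.<-≤-trans N<[2t+1][t+1] (ℕₚ.*-monoʳ-≤ (suc (t ℕ.+ t)) t<m))

  odd-multiple-[]≢0# : ∀ m → 0 < m → m ≤ suc (t ℕ.+ t) → [ suc (t ℕ.+ t) ℕ.* m ] ≢ 0#
  odd-multiple-[]≢0# m 0<m m≤2t+1 [W]≡0 with []≡[0]⇒∣ [W]≡0
  ... | divides zero W≡0 = ℕₚ.<⇒≢ (ℕₚ.*-mono-≤ {1} {suc (t ℕ.+ t)} (s≤s z≤n) 0<m) (sym W≡0)
  ... | divides (suc zero) W≡N = odd-multiple≢N m (trans W≡N (ℕₚ.+-identityʳ (N t)))
  ... | divides (suc (suc q)) W≡ = ℕₚ.<-irrefl refl (begin-strict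
      W                                     ≤⟨ ℕₚ.*-monoʳ-≤ (suc (t ℕ.+ t)) m≤2t+1 ⟩
      suc (t ℕ.+ t) ℕ.* suc (t ℕ.+ t)       <⟨ ℕₚ.≤-reflexive (1+[2t+1]²≡2N t) ⟩
      2 ℕ.* N t                             ≤⟨ ℕₚ.*-monoˡ-≤ (N t) (s≤s (s≤s (z≤n {q}))) ⟩
      suc (suc q) ℕ.* N t                   ≡⟨ W≡ ⟨
      W                                     ∎)
    where
    open ℕₚ.≤-Reasoning
    W : ℕ
    W = suc (t ℕ.+ t) ℕ.* m

  cross-term-equal-signs : ∀ {d d′ e e′} → d ℕ.+ d′ ≡ t → e ℕ.+ e′ ≡ t →
    [ (suc t ℕ.+ d) ℕ.* (suc t ℕ.+ e) ] ≢ [ d′ ℕ.* e′ ]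
  cross-term-equal-signs {d} {d′} {e} {e′} hd he [X]≡[Y] =
    odd-multiple-[]≢0# (suc (d ℕ.+ e)) (s≤s z≤n)
      (s≤s (ℕₚ.+-mono-≤ (ℕₚ.m+n≤o⇒m≤o d (ℕₚ.≤-reflexive hd))
                        (ℕₚ.m+n≤o⇒m≤o e (ℕₚ.≤-reflexive he))))
      (+-cancelˡ [ Y ] [ W ] 0# (begin
        [ Y ] + [ W ]   ≡⟨ []-+ Y W ⟨
        [ Y ℕ.+ W ]     ≡⟨ cong [_] (cross-difference hd he) ⟨
        [ X ]           ≡⟨ [X]≡[Y] ⟩
        [ Y ]           ≡⟨ +-identityʳ [ Y ] ⟨
        [ Y ] + 0#      ∎))
    where
    open ≡-Reasoning
    X Y W : ℕ
    X = (suc t ℕ.+ d) ℕ.* (suc t ℕ.+ e)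
    Y = d′ ℕ.* e′
    W = suc (t ℕ.+ t) ℕ.* suc (d ℕ.+ e)

  cross-term-opposite-signs : ∀ {d d′ e e′} → d ℕ.+ d′ ≡ t → e ℕ.+ e′ ≡ t →
    [ (suc t ℕ.+ d) ℕ.* (suc t ℕ.+ e) ] + [ d′ ℕ.* e′ ] ≡ 0# → d ≡ 0 × e ≡ 0
  cross-term-opposite-signs {d} {d′} {e} {e′} hd he [X]+[Y]≡0 =
    ℕₚ.m+n≡0⇒m≡0 d d+e≡0 , ℕₚ.m+n≡0⇒n≡0 d d+e≡0
    where
    open ≡-Reasoning
    X Y R : ℕ
    X = (suc t ℕ.+ d) ℕ.* (suc t ℕ.+ e)
    Y = d′ ℕ.* e′
    R = d ℕ.+ e ℕ.+ 2 ℕ.* (d ℕ.* e)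
    [R]≡0 : [ R ] ≡ 0#
    [R]≡0 = begin
      [ R ]              ≡⟨ +-identityˡ [ R ] ⟨
      0# + [ R ]         ≡⟨ cong (_+ [ R ]) [n]≡[0] ⟨
      [ N t ] + [ R ]    ≡⟨ []-+ (N t) R ⟨
      [ N t ℕ.+ R ]      ≡⟨ cong [_] (cross-sum hd he) ⟨
      [ X ℕ.+ Y ]        ≡⟨ []-+ X Y ⟩
      [ X ] + [ Y ]      ≡⟨ [X]+[Y]≡0 ⟩
      0#                 ∎
    d≤t : d ≤ t
    d≤t = ℕₚ.m+n≤o⇒m≤o d (ℕₚ.≤-reflexive hd)
    e≤t : e ≤ t
    e≤t = ℕₚ.m+n≤o⇒m≤o e (ℕₚ.≤-reflexive he)
    R<N : R < N t
    R<N = ℕₚ.≤-<-trans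
      (ℕₚ.+-mono-≤ (ℕₚ.+-mono-≤ d≤t e≤t) (ℕₚ.*-monoʳ-≤ 2 (ℕₚ.*-mono-≤ d≤t e≤t)))
      (ℕₚ.≤-reflexive (1+2t+2t²≡N t))
    d+e≡0 : d ℕ.+ e ≡ 0
    d+e≡0 = ℕₚ.m+n≡0⇒m≡0 (d ℕ.+ e) ([]≡[0]⇒≡0 R<N [R]≡0)

  cross-term≡0⇒d≡e≡0 : ∀ {d d′ e e′} σ → d ℕ.+ d′ ≡ t → e ℕ.+ e′ ≡ t →
    [ (suc t ℕ.+ d) ℕ.* (suc t ℕ.+ e) ] - σ ◃ₙ [ d′ ℕ.* e′ ] ≡ 0# → σ ≡ Sign.- × d ≡ 0 × e ≡ 0
  cross-term≡0⇒d≡e≡0 {d} {d′} {e} {e′} Sign.+ hd he det =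
    ⊥-elim (cross-term-equal-signs hd he
      (x∙y⁻¹≈ε⇒x≈y [ (suc t ℕ.+ d) ℕ.* (suc t ℕ.+ e) ] [ d′ ℕ.* e′ ] det))
  cross-term≡0⇒d≡e≡0 {d} {d′} {e} {e′} Sign.- hd he det = refl , cross-term-opposite-signs hd he
    (trans (cong ([ (suc t ℕ.+ d) ℕ.* (suc t ℕ.+ e) ] +_) (sym (-‿involutive [ d′ ℕ.* e′ ]))) det)

  NearAxis : Fin (N t) → Fin (N t) → Set
  NearAxis u v = ∃ λ d → d ℕ.+ leeEntry v ≡ t × u ≡ [ suc t ℕ.+ d ]

  Far : Fin (N t) → Fin (N t) → Set
  Far u v = u ≢ 0# → 2 ℕ.* t ℕ.+ 1 ≤ leeEntry u ℕ.+ leeEntry v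

  private
    Far-[] : ∀ {u v m} → Far u v → u ≡ [ m ] → 0 < m → m < N t → 2 ℕ.* t ℕ.+ 1 ≤ m ℕ.+ leeEntry v
    Far-[] {u} {v} {m} far u≡[m] 0<m m<N = ℕₚ.≤-trans (far u≢0) (ℕₚ.+-monoˡ-≤ (leeEntry v) lee-u≤m)
      where
      u≢0 : u ≢ 0#
      u≢0 u≡0 = ℕₚ.<⇒≢ 0<m (sym ([]≡[0]⇒≡0 m<N (trans (sym u≡[m]) u≡0)))
      lee-u≤m : leeEntry u ≤ m
      lee-u≤m = subst (λ x → leeEntry x ≤ m) (sym u≡[m]) (leeEntry-◃ₙ-≤ Sign.+ m)

    2t+1≤1+t+x⇒t≤x : ∀ {x} → 2 ℕ.* t ℕ.+ 1 ≤ suc t ℕ.+ x → t ≤ x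
    2t+1≤1+t+x⇒t≤x {x} h = ℕₚ.+-cancelˡ-≤ (suc t) t x (subst (_≤ suc t ℕ.+ x) (2t+1≡suc[t+t] t) h)

  near-axis⁻ : ∀ {u v L} → L ℕ.+ leeEntry v ≤ t → u ≡ [ suc t ] + [ L ] → Far u v → NearAxis u v
  near-axis⁻ {u} {v} {L} close u≡ far = L , L+v≡t , u≡[1+t+L]
    where
    u≡[1+t+L] : u ≡ [ suc t ℕ.+ L ]
    u≡[1+t+L] = trans u≡ (sym ([]-+ (suc t) L))
    1+t+L<N : suc t ℕ.+ L < N t
    1+t+L<N = ℕₚ.≤-<-trans (ℕₚ.+-monoʳ-≤ (suc t) (ℕₚ.m+n≤o⇒m≤o L close)) 2t+1<N
    L+v≡t : L ℕ.+ leeEntry v ≡ t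
    L+v≡t = ℕₚ.≤-antisym close (2t+1≤1+t+x⇒t≤x
      (subst (2 ℕ.* t ℕ.+ 1 ≤_) (ℕₚ.+-assoc (suc t) L (leeEntry v))
        (Far-[] far u≡[1+t+L] (s≤s z≤n) 1+t+L<N)))

  near-axis⁺ : ∀ {u v L} → L ℕ.+ leeEntry v ≤ t → u ≡ [ suc t ] - [ L ] → Far u v → NearAxis u v
  near-axis⁺ {u} {v} {L} close u≡ far = 0 , v≡t , u≡[1+t+0]
    where
    L≤t : L ≤ t
    L≤t = ℕₚ.m+n≤o⇒m≤o L close
    m : ℕ
    m = suc t ℕ.∸ L
    u≡[m] : u ≡ [ m ]
    u≡[m] = trans u≡ (sym ([]-∸ (ℕₚ.m≤n⇒m≤1+n L≤t)))
    0<m : 0 < m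
    0<m = subst (0 <_) (sym (ℕₚ.+-∸-assoc 1 L≤t)) (s≤s z≤n)
    m<N : m < N t
    m<N = ℕₚ.≤-<-trans (ℕₚ.m∸n≤m (suc t) L) (ℕₚ.≤-<-trans (s≤s (ℕₚ.m≤m+n t t)) 2t+1<N)
    t≤v : t ≤ leeEntry v
    t≤v = 2t+1≤1+t+x⇒t≤x
      (ℕₚ.≤-trans (Far-[] far u≡[m] 0<m m<N) (ℕₚ.+-monoˡ-≤ (leeEntry v) (ℕₚ.m∸n≤m (suc t) L)))
    v≡t : leeEntry v ≡ t
    v≡t = ℕₚ.≤-antisym (ℕₚ.m+n≤o⇒n≤o L close) t≤v
    L≡0 : L ≡ 0
    L≡0 = ℕₚ.n≤0⇒n≡0 (ℕₚ.+-cancelʳ-≤ (leeEntry v) L 0 (ℕₚ.≤-trans close t≤v))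
    u≡[1+t+0] : u ≡ [ suc t ℕ.+ 0 ]
    u≡[1+t+0] = trans u≡[m] (cong [_] (trans (cong (suc t ℕ.∸_) L≡0) (sym (ℕₚ.+-identityʳ (suc t)))))

  near-axis : ∀ u v → leeEntry ([ suc t ] - u) ℕ.+ leeEntry (0# - v) ≤ t → Far u v → NearAxis u v
  near-axis u v close far = by-sign (leeEntry-signed ([ suc t ] - u))
    where
    L : ℕ
    L = leeEntry ([ suc t ] - u)
    close′ : L ℕ.+ leeEntry v ≤ t
    close′ = subst (λ x → L ℕ.+ x ≤ t) (leeEntry-0#- v) close
    by-sign : (∃ λ s → [ suc t ] - u ≡ s ◃ₙ [ L ]) → NearAxis u v
    by-sign (Sign.- , e) =
      near-axis⁻ close′ (trans (x-u≡y⇒u≡x-y [ suc t ] u e) (cong ([ suc t ] +_) (-‿involutive [ L ]))) far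
    by-sign (Sign.+ , e) = near-axis⁺ close′ (x-u≡y⇒u≡x-y [ suc t ] u e) far

  near-axis-pair⇒quarterTurn : ∀ {u₁ v₁ u₂ v₂} → NearAxis u₁ v₁ → NearAxis v₂ u₂ →
    u₁ * v₂ - v₁ * u₂ ≡ 0# →
    ∃ λ s → u₁ ≡ [ suc t ] × v₁ ≡ s ◃ₙ [ t ] × u₂ ≡ - (s ◃ₙ [ t ]) × v₂ ≡ [ suc t ]
  near-axis-pair⇒quarterTurn {u₁} {v₁} {u₂} {v₂} (d , hd , u₁≡) (e , he , v₂≡) det =
    conclude (cross-term≡0⇒d≡e≡0 (s Sign.* s′) hd he (begin
      [ X ] - (s Sign.* s′) ◃ₙ [ d′ ℕ.* e′ ]
        ≡⟨ cong₂ (λ x y → x - (s Sign.* s′) ◃ₙ y) ([]-* (suc t ℕ.+ d) (suc t ℕ.+ e)) ([]-* d′ e′) ⟩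
      [ suc t ℕ.+ d ] * [ suc t ℕ.+ e ] - (s Sign.* s′) ◃ₙ ([ d′ ] * [ e′ ])
        ≡⟨ cong (λ z → [ suc t ℕ.+ d ] * [ suc t ℕ.+ e ] - z) (◃ₙ-* s s′ [ d′ ] [ e′ ]) ⟨
      [ suc t ℕ.+ d ] * [ suc t ℕ.+ e ] - (s ◃ₙ [ d′ ]) * (s′ ◃ₙ [ e′ ])
        ≡⟨ cong₂ _-_ (cong₂ _*_ u₁≡ v₂≡) (cong₂ _*_ v₁≡ u₂≡) ⟨
      u₁ * v₂ - v₁ * u₂
        ≡⟨ det ⟩
      0# ∎))
    where
    open ≡-Reasoning
    X d′ e′ : ℕ
    X = (suc t ℕ.+ d) ℕ.* (suc t ℕ.+ e)
    d′ = leeEntry v₁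
    e′ = leeEntry u₂
    s s′ : Sign
    s = proj₁ (leeEntry-signed v₁)
    s′ = proj₁ (leeEntry-signed u₂)
    v₁≡ : v₁ ≡ s ◃ₙ [ d′ ]
    v₁≡ = proj₂ (leeEntry-signed v₁)
    u₂≡ : u₂ ≡ s′ ◃ₙ [ e′ ]
    u₂≡ = proj₂ (leeEntry-signed u₂)
    [suc-t+0]≡[suc-t] : [ suc t ℕ.+ 0 ] ≡ [ suc t ]
    [suc-t+0]≡[suc-t] = cong [_] (ℕₚ.+-identityʳ (suc t))
    conclude : s Sign.* s′ ≡ Sign.- × d ≡ 0 × e ≡ 0 →
               ∃ λ s → u₁ ≡ [ suc t ] × v₁ ≡ s ◃ₙ [ t ] × u₂ ≡ - (s ◃ₙ [ t ]) × v₂ ≡ [ suc t ]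
    conclude (ss′≡- , d≡0 , e≡0) =
      s ,
      trans u₁≡ (trans (cong (λ z → [ suc t ℕ.+ z ]) d≡0) [suc-t+0]≡[suc-t]) ,
      trans v₁≡ (cong (λ z → s ◃ₙ [ z ]) (trans (cong (ℕ._+ d′) (sym d≡0)) hd)) ,
      trans u₂≡ (trans (cong₂ (λ σ z → σ ◃ₙ [ z ]) s′≡opposite-s (trans (cong (ℕ._+ e′) (sym e≡0)) he))
                       (◃ₙ-opposite s [ t ])) ,
      trans v₂≡ (trans (cong (λ z → [ suc t ℕ.+ z ]) e≡0) [suc-t+0]≡[suc-t])
      where
      s′≡opposite-s : s′ ≡ Sign.opposite s
      s′≡opposite-s = Signₚ.*-cancelˡ-≡ s s′ (Sign.opposite s) (trans ss′≡- (sym (Signₚ.s*opposite[s]≡- s)))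

  module _ {a b : Fin (N t)} (perfect : IsPerfectCode t (genCode a b)) where

    nonzero-codeword-weight : ∀ k → (k * a , k * b) ≢ (0# , 0#) →
                              2 ℕ.* t ℕ.+ 1 ≤ leeEntry (k * a) ℕ.+ leeEntry (k * b)
    nonzero-codeword-weight k k≢0 = subst (2 ℕ.* t ℕ.+ 1 ≤_)
      (cong₂ (λ x y → leeEntry x ℕ.+ leeEntry y) (x-0y≡x (k * a) a) (x-0y≡x (k * b) b))
      (proj₁ (proj₁ perfect) _ _ (k , refl) (0# , refl)
        (λ e → k≢0 (trans e (cong₂ _,_ (zeroˡ a) (zeroˡ b)))))
      where
      x-0y≡x : ∀ x y → x - 0# * y ≡ x
      x-0y≡x = solve 2 (λ x y → x :- con (ℤ.+ 0) :* y := x) refl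

    axis-codeword : ∃ λ k → NearAxis (k * a) (k * b)
    axis-codeword with proj₂ perfect ([ suc t ] , 0#)
    ... | _ , (k , refl) , close = k , near-axis (k * a) (k * b) close
      (λ ka≢0 → nonzero-codeword-weight k (ka≢0 ∘ cong proj₁))

    axis-codeword′ : ∃ λ k → NearAxis (k * b) (k * a)
    axis-codeword′ with proj₂ perfect (0# , [ suc t ])
    ... | _ , (k , refl) , close = k ,
      near-axis (k * b) (k * a)
        (subst (_≤ t) (ℕₚ.+-comm (leeEntry (0# - k * a)) (leeEntry ([ suc t ] - k * b))) close)
        (λ kb≢0 → subst (2 ℕ.* t ℕ.+ 1 ≤_) (ℕₚ.+-comm (leeEntry (k * a)) (leeEntry (k * b)))
          (nonzero-codeword-weight k (kb≢0 ∘ cong proj₂)))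

    -- let rather than with: abstracting over these pairs makes Agda normalise
    -- their NearAxis types, which is prohibitively expensive.
    quarterTurn-multiplier : ∃ λ m → m * a ≡ - b × m * b ≡ a
    quarterTurn-multiplier =
      let k₁ , near₁ = axis-codeword
          k₂ , near₂ = axis-codeword′
          s , k₁a≡ , k₁b≡ , k₂a≡ , k₂b≡ =
            near-axis-pair⇒quarterTurn near₁ near₂ (det-multiples≡0 a b k₁ k₂)
      in quarterTurn-from-axes {a} {b} {k₁} {k₂} {[ t ]} {s ◃ₙ 1#} (◃ₙ-1#-squared s)
           (trans k₁a≡ ([]-+ 1 t)) (trans k₁b≡ (◃ₙ-as-* s [ t ]))
           (trans k₂a≡ (cong -_ (◃ₙ-as-* s [ t ]))) (trans k₂b≡ ([]-+ 1 t))

theorem7 : (t : ℕ) → 1 ≤ t → (a b x₁ x₂ : Fin (N t)) →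
    IsPerfectCode t (genCode a b) →
    (S : Array) → PerfectSudoku t (translate (x₁ , x₂) (genCode a b)) S →
    (g : GWord) →
    PerfectSudoku t (translate (x₁ , x₂) (genCode a b)) (⟦ g ⟧ a b x₁ x₂ S)
theorem7 t 1≤t a b x₁ x₂ perfect _ sudoku g = preserved g sudoku
  where
  open Modular (N t)
  open PerfectLeeCodes t 1≤t using (quarterTurn-multiplier)

  C : Code
  C = translate (x₁ , x₂) (genCode a b)
  k₁ k₂ : Fin (N t)
  k₁ = x₁ - x₂
  k₂ = x₁ + x₂ + 1#

  rotation : CodeSymmetry C
  rotation = let m , ma≡-b , mb≡a = quarterTurn-multiplier perfect in
             rotation-symmetry a b x₁ x₂ m ma≡-b mb≡a

  translation : CodeSymmetry C
  translation = translation-symmetry a b x₁ x₂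

  preserved : ∀ g {S} → PerfectSudoku t C S → PerfectSudoku t C (⟦ g ⟧ a b x₁ x₂ S)
  preserved ε       sudoku = sudoku
  preserved g₁      sudoku = PerfectSudoku-pullback rotation sudoku
    (Latin-transpose
      (Latin-reindex (-ʳ-injective k₂ ∘ opposite-injective) (-ʳ-injective k₁) (proj₁ sudoku)))
  preserved g₁⁻¹    sudoku = PerfectSudoku-pullback (inverse rotation) sudoku
    (Latin-transpose
      (Latin-reindex (-ʳ-injective (- k₁)) (opposite-injective ∘ -ʳ-injective (- k₂)) (proj₁ sudoku)))
  preserved g₂      sudoku = PerfectSudoku-pullback translation sudoku
    (Latin-reindex (-ʳ-injective a) (-ʳ-injective b) (proj₁ sudoku))
  preserved g₂⁻¹    sudoku = PerfectSudoku-pullback (inverse translation) sudoku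
    (Latin-reindex (-ʳ-injective (- a)) (-ʳ-injective (- b)) (proj₁ sudoku))
  preserved (w ∙ v) sudoku = preserved w (preserved v sudoku)
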